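{- For every prime $p\ge 3$, $$!p\equiv \left[\frac{(p-1)!}{e}\right]+1 \pmod p,$$ where $[x]$ denotes the integer part of $x$.
   Context: For a positive integer $n$, the left factorial is $!n=\sum_{i=0}^{n-1} i!$; $e$ is the base of the natural logarithm. -}

module Defs where

open import Data.Nat as ℕ using (ℕ; zero; suc; _!)
open import Data.Nat.Properties using (_!≢0)
open import Data.Integer using (+_)
open import Data.Rational using (ℚ; _/_; _+_; _*_; _≤_; _<_; 0ℚ)
open import Data.Product using (Σ; _×_)

leftFact : ℕ → ℕ
leftFact zero    = 0
leftFact (suc n) = leftFact n ℕ.+ n !

eSum : ℕ → ℚ
eSum zero    = (+ 1) / 1
eSum (suc k) = eSum k + (_/_ (+ 1) (suc k !) {{suc k !≢0}})

-- "m ≤ x" for the real x = N/e, i.e. m·e ≤ N.  Since e = sup_k eSum k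
-- (strictly increasing partial sums), m·e ≤ N  ⇔  ∀ k, m·eSum k ≤ N.
LeDivE : ℕ → ℕ → Set
LeDivE m N = ∀ k → ((+ m) / 1) * eSum k ≤ (+ N) / 1

-- "N/e < m" i.e. N < m·e  ⇔  ∃ k, N < m·eSum k.
LtDivE : ℕ → ℕ → Set
LtDivE N m = Σ ℕ λ k → (+ N) / 1 < ((+ m) / 1) * eSum k

IsFloorDivE : ℕ → ℕ → Set
IsFloorDivE N m = LeDivE m N × LtDivE N (suc m)

-- Let Dₙ = n! Σ_{i≤n} (−1)ⁱ/i! be the number of derangements: D₀ = 1 and
-- Dₙ₊₁ = (n + 1) Dₙ + (−1)ⁿ⁺¹.  Modulo p = k + r + 1 we have k + 1 ≡ −(r + 1), so an
-- induction on k gives r! Dₖ ≡ (−1)ᵏ (!p − !r); with r = 0 and p odd this is Dₚ₋₁ ≡ !p.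
-- On the other hand 1/e lies strictly between consecutive partial sums of Σ (−1)ⁱ/i!,
-- so for even n we get Dₙ − 1 < n!/e < Dₙ, i.e. [n!/e] = Dₙ − 1.  Without reals, these
-- comparisons with e are made against its partial sums, using that the alternating partial
-- sums Sⱼ = Σ_{i≤j} (−1)ⁱ/i! satisfy Σ_{b≤s} S_{s−b}/b! = 1 (the series of e⁻¹ times that
-- of e is 1).  Primality is used only to know that p is odd.
module Submission where

open import Defs

module _ where

  open import Data.Empty using (⊥; ⊥-elim)
  open import Data.Nat as ℕ using (ℕ; zero; suc; _!; _∸_; s≤s; z≤n)
  import Data.Nat.Properties as ℕP
  open import Data.Nat.Properties using (_!≢0)
  open import Data.Nat.Primality using (Prime; composite)
  open import Data.Nat.Divisibility using (divides)
  import Data.Nat.Tactic.RingSolver as ℕSolver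
  open import Data.Integer as ℤ using (ℤ; +_)
  import Data.Integer.Properties as ℤP
  import Data.Integer.Divisibility as Unsigned
  open import Data.Integer.Divisibility.Signed as Signed
    using (_∣_; ∣-reflexive; ∣m⇒∣-m; ∣m⇒∣m*n; ∣m∣n⇒∣m-n; ∣⇒∣ᵤ)
  import Data.Integer.Tactic.RingSolver as ℤSolver
  open import Data.Rational as ℚ using (ℚ; _/_; _+_; _*_; _-_; -_; _≤_; _<_; 0ℚ; 1ℚ)
  import Data.Rational.Properties as ℚP
  import Data.Rational.Unnormalised as ℚᵘ
  import Data.Rational.Unnormalised.Properties as ℚᵘP
  open import Data.Rational.Solver using (module +-*-Solver)
  open import Data.Product using (Σ; ∃; _×_; _,_)
  open import Data.Sum using (_⊎_; inj₁; inj₂)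
  open import Relation.Binary.Definitions using (tri<; tri≈; tri>)
  open import Relation.Binary.PropositionalEquality


  fromℚᵘ-homo-+ : ∀ p q → ℚ.fromℚᵘ (p ℚᵘ.+ q) ≡ ℚ.fromℚᵘ p + ℚ.fromℚᵘ q
  fromℚᵘ-homo-+ p q = ℚP.toℚᵘ-injective (begin
    ℚ.toℚᵘ (ℚ.fromℚᵘ (p ℚᵘ.+ q))              ≈⟨ ℚP.toℚᵘ-fromℚᵘ (p ℚᵘ.+ q) ⟩
    p ℚᵘ.+ q                                   ≈⟨ ℚᵘP.+-cong (ℚP.toℚᵘ-fromℚᵘ p) (ℚP.toℚᵘ-fromℚᵘ q) ⟨
    ℚ.toℚᵘ (ℚ.fromℚᵘ p) ℚᵘ.+ ℚ.toℚᵘ (ℚ.fromℚᵘ q) ≈⟨ ℚP.toℚᵘ-homo-+ (ℚ.fromℚᵘ p) (ℚ.fromℚᵘ q) ⟨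
    ℚ.toℚᵘ (ℚ.fromℚᵘ p + ℚ.fromℚᵘ q)           ∎)
    where open ℚᵘP.≃-Reasoning

  fromℚᵘ-homo-* : ∀ p q → ℚ.fromℚᵘ (p ℚᵘ.* q) ≡ ℚ.fromℚᵘ p * ℚ.fromℚᵘ q
  fromℚᵘ-homo-* p q = ℚP.toℚᵘ-injective (begin
    ℚ.toℚᵘ (ℚ.fromℚᵘ (p ℚᵘ.* q))              ≈⟨ ℚP.toℚᵘ-fromℚᵘ (p ℚᵘ.* q) ⟩
    p ℚᵘ.* q                                   ≈⟨ ℚᵘP.*-cong (ℚP.toℚᵘ-fromℚᵘ p) (ℚP.toℚᵘ-fromℚᵘ q) ⟨
    ℚ.toℚᵘ (ℚ.fromℚᵘ p) ℚᵘ.* ℚ.toℚᵘ (ℚ.fromℚᵘ q) ≈⟨ ℚP.toℚᵘ-homo-* (ℚ.fromℚᵘ p) (ℚ.fromℚᵘ q) ⟨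
    ℚ.toℚᵘ (ℚ.fromℚᵘ p * ℚ.fromℚᵘ q)           ∎)
    where open ℚᵘP.≃-Reasoning

  fromℤ : ℤ → ℚ
  fromℤ z = z / 1

  fromℕ : ℕ → ℚ
  fromℕ n = fromℤ (+ n)

  fromℤ-+ : ∀ a b → fromℤ (a ℤ.+ b) ≡ fromℤ a + fromℤ b
  fromℤ-+ a b = trans
    (ℚP.fromℚᵘ-cong {ℚᵘ.mkℚᵘ (a ℤ.+ b) 0} {ℚᵘ.mkℚᵘ a 0 ℚᵘ.+ ℚᵘ.mkℚᵘ b 0} (ℚᵘ.*≡* (denominator-one a b)))
    (fromℚᵘ-homo-+ (ℚᵘ.mkℚᵘ a 0) (ℚᵘ.mkℚᵘ b 0))
    where
    denominator-one : ∀ a b → (a ℤ.+ b) ℤ.* + 1 ≡ (a ℤ.* + 1 ℤ.+ b ℤ.* + 1) ℤ.* + 1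
    denominator-one = ℤSolver.solve-∀

  fromℤ-* : ∀ a b → fromℤ (a ℤ.* b) ≡ fromℤ a * fromℤ b
  fromℤ-* a b = fromℚᵘ-homo-* (ℚᵘ.mkℚᵘ a 0) (ℚᵘ.mkℚᵘ b 0)

  fromℤ-neg : ∀ z → fromℤ (ℤ.- z) ≡ - fromℤ z
  fromℤ-neg (+ zero)    = refl
  fromℤ-neg (+ suc n)   = refl
  fromℤ-neg ℤ.-[1+ n ]  = solve 1 (λ x → x := :- (:- x)) refl (fromℤ (+ suc n))
    where open +-*-Solver

  fromℕ-+ : ∀ m n → fromℕ (m ℕ.+ n) ≡ fromℕ m + fromℕ n
  fromℕ-+ m n = trans (cong fromℤ (ℤP.pos-+ m n)) (fromℤ-+ (+ m) (+ n))

  fromℕ-* : ∀ m n → fromℕ (m ℕ.* n) ≡ fromℕ m * fromℕ n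
  fromℕ-* m n = trans (cong fromℤ (ℤP.pos-* m n)) (fromℤ-* (+ m) (+ n))

  p≤p+q : ∀ p {q} → 0ℚ ≤ q → p ≤ p + q
  p≤p+q p {q} 0≤q = begin
    p      ≡⟨ ℚP.+-identityʳ p ⟨
    p + 0ℚ ≤⟨ ℚP.+-monoʳ-≤ p 0≤q ⟩
    p + q  ∎
    where open ℚP.≤-Reasoning

  p-q≤p : ∀ p {q} → 0ℚ ≤ q → p - q ≤ p
  p-q≤p p {q} 0≤q = begin
    p - q   ≤⟨ ℚP.+-monoʳ-≤ p (ℚP.neg-antimono-≤ 0≤q) ⟩
    p - 0ℚ  ≡⟨ ℚP.+-identityʳ p ⟩
    p       ∎
    where open ℚP.≤-Reasoning

  p≤q⇒0≤q-p : ∀ {p q} → p ≤ q → 0ℚ ≤ q - p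
  p≤q⇒0≤q-p {p} {q} p≤q = begin
    0ℚ     ≡⟨ ℚP.+-inverseʳ p ⟨
    p - p  ≤⟨ ℚP.+-monoˡ-≤ (- p) p≤q ⟩
    q - p  ∎
    where open ℚP.≤-Reasoning

  *-monoʳ-≤-nonNeg : ∀ {p q} r → 0ℚ ≤ r → p ≤ q → p * r ≤ q * r
  *-monoʳ-≤-nonNeg r 0≤r = ℚP.*-monoʳ-≤-nonNeg r {{ℚ.nonNegative 0≤r}}

  *-monoˡ-≤-nonNeg : ∀ {p q} r → 0ℚ ≤ r → p ≤ q → r * p ≤ r * q
  *-monoˡ-≤-nonNeg r 0≤r = ℚP.*-monoˡ-≤-nonNeg r {{ℚ.nonNegative 0≤r}}

  0≤p*q : ∀ {p q} → 0ℚ ≤ p → 0ℚ ≤ q → 0ℚ ≤ p * q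
  0≤p*q {p} {q} 0≤p 0≤q = ℚP.nonNegative⁻¹ (p * q)
    {{ℚP.nonNeg*nonNeg⇒nonNeg p {{ℚ.nonNegative 0≤p}} q {{ℚ.nonNegative 0≤q}}}}

  fromℕ-nonNeg : ∀ n → 0ℚ ≤ fromℕ n
  fromℕ-nonNeg n = ℚP.nonNegative⁻¹ (fromℕ n) {{ℚP.normalize-nonNeg n 1}}

  fromℕ-mono-≤ : ∀ {m n} → m ℕ.≤ n → fromℕ m ≤ fromℕ n
  fromℕ-mono-≤ {m} {n} m≤n = begin
    fromℕ m                    ≤⟨ p≤p+q (fromℕ m) (fromℕ-nonNeg (n ∸ m)) ⟩
    fromℕ m + fromℕ (n ∸ m)    ≡⟨ fromℕ-+ m (n ∸ m) ⟨
    fromℕ (m ℕ.+ (n ∸ m))      ≡⟨ cong fromℕ (ℕP.m+[n∸m]≡n m≤n) ⟩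
    fromℕ n                    ∎
    where open ℚP.≤-Reasoning

  fromℕ-suc : ∀ n → fromℕ (suc n) ≡ fromℕ n + 1ℚ
  fromℕ-suc n = trans (cong fromℕ (ℕP.+-comm 1 n)) (fromℕ-+ n 1)

  fromℕ-mono-< : ∀ {m n} → m ℕ.< n → fromℕ m < fromℕ n
  fromℕ-mono-< {m} m<n = ℚP.<-≤-trans m<1+m (fromℕ-mono-≤ m<n)
    where
    m<1+m : fromℕ m < fromℕ (suc m)
    m<1+m = begin-strict
      fromℕ m       ≡⟨ ℚP.+-identityʳ (fromℕ m) ⟨
      fromℕ m + 0ℚ  <⟨ ℚP.+-monoʳ-< (fromℕ m) (ℚP.positive⁻¹ 1ℚ) ⟩
      fromℕ m + 1ℚ  ≡⟨ fromℕ-suc m ⟨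
      fromℕ (suc m) ∎
      where open ℚP.≤-Reasoning

  fromℕ-pos : ∀ n .{{_ : ℕ.NonZero n}} → 0ℚ < fromℕ n
  fromℕ-pos (suc n) = fromℕ-mono-< {0} {suc n} (s≤s z≤n)

  -- Opaque, since unfolding _/_ makes unification normalise gcd computations.
  opaque
    invFact : ℕ → ℚ
    invFact k = _/_ (+ 1) (k !) {{k !≢0}}

    invFact-unfold : ∀ k → invFact k ≡ _/_ (+ 1) (k !) {{k !≢0}}
    invFact-unfold k = refl

    invFact*fact≡1 : ∀ k → invFact k * fromℕ (k !) ≡ 1ℚ
    invFact*fact≡1 k = lemma (k !) {{k !≢0}}
      where
      lemma : ∀ d .{{_ : ℕ.NonZero d}} → (+ 1 / d) * fromℕ d ≡ 1ℚ
      lemma (suc d) = trans (sym (fromℚᵘ-homo-* (ℚᵘ.mkℚᵘ (+ 1) d) (ℚᵘ.mkℚᵘ (+ suc d) 0)))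
        (ℚP.fromℚᵘ-cong {ℚᵘ.mkℚᵘ (+ 1) d ℚᵘ.* ℚᵘ.mkℚᵘ (+ suc d) 0} {ℚᵘ.1ℚᵘ}
          (ℚᵘ.*≡* (ℤP.*-assoc (+ 1) (+ suc d) (+ 1))))

    invFact-pos : ∀ k → 0ℚ < invFact k
    invFact-pos k = ℚP.positive⁻¹ (invFact k) {{ℚP.normalize-pos 1 (k !) {{k !≢0}}}}

  invFact-nonNeg : ∀ k → 0ℚ ≤ invFact k
  invFact-nonNeg k = ℚP.<⇒≤ (invFact-pos k)

  invFact-suc : ∀ k → invFact (suc k) * fromℕ (suc k) ≡ invFact k
  invFact-suc k = begin
    invFact (suc k) * fromℕ (suc k)                      ≡⟨ ℚP.*-identityʳ _ ⟨
    invFact (suc k) * fromℕ (suc k) * 1ℚ                 ≡⟨ cong (invFact (suc k) * fromℕ (suc k) *_) (sym (invFact*fact≡1 k)) ⟩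
    invFact (suc k) * fromℕ (suc k) * (invFact k * fromℕ (k !))
      ≡⟨ solve 4 (λ a b c d → a :* b :* (c :* d) := a :* (b :* d) :* c) refl (invFact (suc k)) (fromℕ (suc k)) (invFact k) (fromℕ (k !)) ⟩
    invFact (suc k) * (fromℕ (suc k) * fromℕ (k !)) * invFact k
      ≡⟨ cong (λ x → invFact (suc k) * x * invFact k) (fromℕ-* (suc k) (k !)) ⟨
    invFact (suc k) * fromℕ (suc k !) * invFact k        ≡⟨ cong (_* invFact k) (invFact*fact≡1 (suc k)) ⟩
    1ℚ * invFact k                                       ≡⟨ ℚP.*-identityˡ (invFact k) ⟩
    invFact k                                            ∎
    where
    open ≡-Reasoning
    open +-*-Solver

  invFact-antitone : ∀ {m n} → m ℕ.≤ n → invFact n ≤ invFact m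
  invFact-antitone {m} {n} m≤n with ℕP.m≤n⇒∃[o]m+o≡n m≤n
  ... | d , refl = go m d
    where
    go : ∀ m d → invFact (m ℕ.+ d) ≤ invFact m
    go m zero    = ℚP.≤-reflexive (cong invFact (ℕP.+-identityʳ m))
    go m (suc d) = begin
      invFact (m ℕ.+ suc d)                       ≡⟨ cong invFact (ℕP.+-suc m d) ⟩
      invFact (suc (m ℕ.+ d))                     ≡⟨ ℚP.*-identityʳ _ ⟨
      invFact (suc (m ℕ.+ d)) * 1ℚ
        ≤⟨ *-monoˡ-≤-nonNeg (invFact (suc (m ℕ.+ d))) (invFact-nonNeg _) (fromℕ-mono-≤ {1} {suc (m ℕ.+ d)} (s≤s z≤n)) ⟩
      invFact (suc (m ℕ.+ d)) * fromℕ (suc (m ℕ.+ d)) ≡⟨ invFact-suc (m ℕ.+ d) ⟩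
      invFact (m ℕ.+ d)                           ≤⟨ go m d ⟩
      invFact m                                   ∎
      where open ℚP.≤-Reasoning

  ∑< : ℕ → (ℕ → ℚ) → ℚ
  ∑< zero    h = 0ℚ
  ∑< (suc n) h = ∑< n h + h n

  ∑<-cong : ∀ n {h h′} → (∀ i → i ℕ.< n → h i ≡ h′ i) → ∑< n h ≡ ∑< n h′
  ∑<-cong zero    eq = refl
  ∑<-cong (suc n) eq = cong₂ _+_ (∑<-cong n (λ i i<n → eq i (ℕP.m<n⇒m<1+n i<n))) (eq n ℕP.≤-refl)

  ∑<-head : ∀ n h → ∑< (suc n) h ≡ h 0 + ∑< n (λ i → h (suc i))
  ∑<-head zero    h = trans (ℚP.+-identityˡ (h 0)) (sym (ℚP.+-identityʳ (h 0)))
  ∑<-head (suc n) h = trans (cong (_+ h (suc n)) (∑<-head n h)) (ℚP.+-assoc (h 0) _ _)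

  ∑<-split : ∀ m n h → ∑< (m ℕ.+ n) h ≡ ∑< m h + ∑< n (λ t → h (m ℕ.+ t))
  ∑<-split m zero    h rewrite ℕP.+-identityʳ m = sym (ℚP.+-identityʳ _)
  ∑<-split m (suc n) h rewrite ℕP.+-suc m n =
    trans (cong (_+ h (m ℕ.+ n)) (∑<-split m n h)) (ℚP.+-assoc (∑< m h) _ _)

  ∑<-+ : ∀ n h h′ → ∑< n (λ i → h i + h′ i) ≡ ∑< n h + ∑< n h′
  ∑<-+ zero    h h′ = refl
  ∑<-+ (suc n) h h′ = trans (cong (_+ (h n + h′ n)) (∑<-+ n h h′))
    (solve 4 (λ a b c d → (a :+ b) :+ (c :+ d) := (a :+ c) :+ (b :+ d)) refl (∑< n h) (∑< n h′) (h n) (h′ n))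
    where open +-*-Solver

  ∑<-*ˡ : ∀ n c h → c * ∑< n h ≡ ∑< n (λ i → c * h i)
  ∑<-*ˡ zero    c h = ℚP.*-zeroʳ c
  ∑<-*ˡ (suc n) c h = trans (ℚP.*-distribˡ-+ c (∑< n h) (h n)) (cong (_+ c * h n) (∑<-*ˡ n c h))

  ∑<-mono-≤ : ∀ n {h h′} → (∀ i → i ℕ.< n → h i ≤ h′ i) → ∑< n h ≤ ∑< n h′
  ∑<-mono-≤ zero    le = ℚP.≤-refl
  ∑<-mono-≤ (suc n) le = ℚP.+-mono-≤ (∑<-mono-≤ n (λ i i<n → le i (ℕP.m<n⇒m<1+n i<n))) (le n ℕP.≤-refl)

  ∑<-nonNeg : ∀ n {h} → (∀ i → i ℕ.< n → 0ℚ ≤ h i) → 0ℚ ≤ ∑< n h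
  ∑<-nonNeg n {h} 0≤h = ℚP.≤-trans (ℚP.≤-reflexive (∑<-zero n)) (∑<-mono-≤ n 0≤h)
    where
    ∑<-zero : ∀ n → 0ℚ ≡ ∑< n (λ _ → 0ℚ)
    ∑<-zero zero    = refl
    ∑<-zero (suc n) = cong (_+ 0ℚ) (∑<-zero n)

  ∑<-≤-const : ∀ n {h} c → (∀ i → i ℕ.< n → h i ≤ c) → ∑< n h ≤ fromℕ n * c
  ∑<-≤-const zero    c le = ℚP.≤-reflexive (sym (ℚP.*-zeroˡ c))
  ∑<-≤-const (suc n) {h} c le = begin
    ∑< n h + h n          ≤⟨ ℚP.+-mono-≤ (∑<-≤-const n c (λ i i<n → le i (ℕP.m<n⇒m<1+n i<n))) (le n ℕP.≤-refl) ⟩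
    fromℕ n * c + c       ≡⟨ solve 2 (λ x c → x :* c :+ c := (x :+ con 1ℚ) :* c) refl (fromℕ n) c ⟩
    (fromℕ n + 1ℚ) * c    ≡⟨ cong (_* c) (fromℕ-suc n) ⟨
    fromℕ (suc n) * c     ∎
    where
    open ℚP.≤-Reasoning
    open +-*-Solver

  eSum≡∑<invFact : ∀ k → eSum k ≡ ∑< (suc k) invFact
  eSum≡∑<invFact zero    = trans (sym (invFact-unfold 0)) (sym (ℚP.+-identityˡ (invFact 0)))
  eSum≡∑<invFact (suc k) = cong₂ _+_ (eSum≡∑<invFact k) (sym (invFact-unfold (suc k)))

  p*q≡0⇒q≡0 : ∀ p {q} → 0ℚ < p → p * q ≡ 0ℚ → q ≡ 0ℚ
  p*q≡0⇒q≡0 p {q} 0<p pq≡0 = begin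
    q                ≡⟨ ℚP.*-identityˡ q ⟨
    1ℚ * q           ≡⟨ cong (_* q) (ℚP.*-inverseˡ p) ⟨
    ℚ.1/ p * p * q   ≡⟨ ℚP.*-assoc (ℚ.1/ p) p q ⟩
    ℚ.1/ p * (p * q) ≡⟨ cong (ℚ.1/ p *_) pq≡0 ⟩
    ℚ.1/ p * 0ℚ      ≡⟨ ℚP.*-zeroʳ (ℚ.1/ p) ⟩
    0ℚ               ∎
    where
    open ≡-Reasoning
    instance
      p≢0 : ℚ.NonZero p
      p≢0 = ℚP.pos⇒nonZero p {{ℚ.positive 0<p}}

  sign : ℕ → ℤ
  sign zero    = + 1
  sign (suc n) = ℤ.- sign n

  sign-even : ∀ i → sign (i ℕ.+ i) ≡ + 1
  sign-even zero    = refl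
  sign-even (suc i) rewrite ℕP.+-suc i i = trans (ℤP.neg-involutive (sign (i ℕ.+ i))) (sign-even i)

  altInvFact : ℕ → ℚ
  altInvFact n = fromℤ (sign n) * invFact n

  altSum : ℕ → ℚ
  altSum n = ∑< (suc n) altInvFact

  altInvFact-suc : ∀ n → fromℕ (suc n) * altInvFact (suc n) ≡ - altInvFact n
  altInvFact-suc n = begin
    fromℕ (suc n) * (fromℤ (ℤ.- sign n) * invFact (suc n))
      ≡⟨ cong (λ x → fromℕ (suc n) * (x * invFact (suc n))) (fromℤ-neg (sign n)) ⟩
    fromℕ (suc n) * (- fromℤ (sign n) * invFact (suc n))
      ≡⟨ solve 3 (λ a s f → a :* (:- s :* f) := :- (s :* (f :* a))) refl (fromℕ (suc n)) (fromℤ (sign n)) (invFact (suc n)) ⟩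
    - (fromℤ (sign n) * (invFact (suc n) * fromℕ (suc n)))  ≡⟨ cong (λ x → - (fromℤ (sign n) * x)) (invFact-suc n) ⟩
    - altInvFact n                                          ∎
    where
    open ≡-Reasoning
    open +-*-Solver

  -- The Cauchy product of the series of e⁻¹ and e has no coefficient beyond the constant one:
  -- writing s + 1 = b + (s + 1 − b) splits (s + 1) times the (s + 1)-st coefficient into the
  -- s-th coefficient and its negative.
  altInvFact⋆invFact-suc≡0 : ∀ s → ∑< (suc (suc s)) (λ b → altInvFact (suc s ∸ b) * invFact b) ≡ 0ℚ
  altInvFact⋆invFact-suc≡0 s = p*q≡0⇒q≡0 (fromℕ (suc s)) (fromℕ-pos (suc s)) (begin
    fromℕ (suc s) * ∑< (suc (suc s)) h                                      ≡⟨ ∑<-*ˡ (suc (suc s)) (fromℕ (suc s)) h ⟩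
    ∑< (suc (suc s)) (λ b → fromℕ (suc s) * h b)                            ≡⟨ ∑<-cong (suc (suc s)) split ⟩
    ∑< (suc (suc s)) (λ b → fromℕ b * h b + fromℕ (suc s ∸ b) * h b)
      ≡⟨ ∑<-+ (suc (suc s)) (λ b → fromℕ b * h b) (λ b → fromℕ (suc s ∸ b) * h b) ⟩
    ∑< (suc (suc s)) (λ b → fromℕ b * h b) + ∑< (suc (suc s)) (λ b → fromℕ (suc s ∸ b) * h b)
      ≡⟨ cong₂ _+_ lower upper ⟩
    ∑< (suc s) c - ∑< (suc s) c                                            ≡⟨ ℚP.+-inverseʳ (∑< (suc s) c) ⟩
    0ℚ                                                                     ∎)
    where
    open ≡-Reasoning
    open +-*-Solver
    h c : ℕ → ℚ
    h b = altInvFact (suc s ∸ b) * invFact b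
    c b = altInvFact (s ∸ b) * invFact b
    split : ∀ b → b ℕ.< suc (suc s) → fromℕ (suc s) * h b ≡ fromℕ b * h b + fromℕ (suc s ∸ b) * h b
    split b b<s+2 = begin
      fromℕ (suc s) * h b                        ≡⟨ cong (λ n → fromℕ n * h b) (ℕP.m+[n∸m]≡n (ℕP.≤-pred b<s+2)) ⟨
      fromℕ (b ℕ.+ (suc s ∸ b)) * h b            ≡⟨ cong (_* h b) (fromℕ-+ b (suc s ∸ b)) ⟩
      (fromℕ b + fromℕ (suc s ∸ b)) * h b        ≡⟨ ℚP.*-distribʳ-+ (h b) (fromℕ b) _ ⟩
      fromℕ b * h b + fromℕ (suc s ∸ b) * h b    ∎
    lower : ∑< (suc (suc s)) (λ b → fromℕ b * h b) ≡ ∑< (suc s) c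
    lower = begin
      ∑< (suc (suc s)) (λ b → fromℕ b * h b)                   ≡⟨ ∑<-head (suc s) _ ⟩
      fromℕ 0 * h 0 + ∑< (suc s) (λ b → fromℕ (suc b) * h (suc b))
        ≡⟨ cong₂ _+_ (ℚP.*-zeroˡ (h 0)) (∑<-cong (suc s) (λ b _ → term b)) ⟩
      0ℚ + ∑< (suc s) c                                         ≡⟨ ℚP.+-identityˡ _ ⟩
      ∑< (suc s) c                                              ∎
      where
      term : ∀ b → fromℕ (suc b) * h (suc b) ≡ c b
      term b = begin
        fromℕ (suc b) * (altInvFact (s ∸ b) * invFact (suc b))
          ≡⟨ solve 3 (λ a g f → a :* (g :* f) := g :* (f :* a)) refl (fromℕ (suc b)) (altInvFact (s ∸ b)) (invFact (suc b)) ⟩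
        altInvFact (s ∸ b) * (invFact (suc b) * fromℕ (suc b))  ≡⟨ cong (altInvFact (s ∸ b) *_) (invFact-suc b) ⟩
        c b                                                     ∎
    upper : ∑< (suc (suc s)) (λ b → fromℕ (suc s ∸ b) * h b) ≡ - ∑< (suc s) c
    upper = begin
      ∑< (suc s) (λ b → fromℕ (suc s ∸ b) * h b) + fromℕ (suc s ∸ suc s) * h (suc s)
        ≡⟨ cong₂ _+_ (∑<-cong (suc s) term) (trans (cong (λ n → fromℕ n * h (suc s)) (ℕP.n∸n≡0 s)) (ℚP.*-zeroˡ (h (suc s)))) ⟩
      ∑< (suc s) (λ b → - 1ℚ * c b) + 0ℚ   ≡⟨ ℚP.+-identityʳ _ ⟩
      ∑< (suc s) (λ b → - 1ℚ * c b)        ≡⟨ ∑<-*ˡ (suc s) (- 1ℚ) c ⟨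
      - 1ℚ * ∑< (suc s) c                  ≡⟨ solve 1 (λ x → :- con 1ℚ :* x := :- x) refl (∑< (suc s) c) ⟩
      - ∑< (suc s) c                       ∎
      where
      term : ∀ b → b ℕ.< suc s → fromℕ (suc s ∸ b) * h b ≡ - 1ℚ * c b
      term b b<s+1 rewrite ℕP.+-∸-assoc 1 (ℕP.≤-pred b<s+1) = begin
        fromℕ (suc (s ∸ b)) * (altInvFact (suc (s ∸ b)) * invFact b)
          ≡⟨ ℚP.*-assoc (fromℕ (suc (s ∸ b))) _ _ ⟨
        fromℕ (suc (s ∸ b)) * altInvFact (suc (s ∸ b)) * invFact b ≡⟨ cong (_* invFact b) (altInvFact-suc (s ∸ b)) ⟩
        - altInvFact (s ∸ b) * invFact b
          ≡⟨ solve 2 (λ g f → :- g :* f := :- con 1ℚ :* (g :* f)) refl (altInvFact (s ∸ b)) (invFact b) ⟩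
        - 1ℚ * c b                                                   ∎

  altSum⋆invFact≡1 : ∀ s → ∑< (suc s) (λ b → altSum (s ∸ b) * invFact b) ≡ 1ℚ
  altSum⋆invFact≡1 zero    = cong (λ f → 0ℚ + (0ℚ + 1ℚ * f) * f) (invFact-unfold 0)
  altSum⋆invFact≡1 (suc s) = begin
    ∑< (suc s) (λ b → altSum (suc s ∸ b) * invFact b) + altSum (suc s ∸ suc s) * invFact (suc s)
      ≡⟨ cong₂ _+_ (∑<-cong (suc s) term) (cong (_* invFact (suc s)) last) ⟩
    ∑< (suc s) (λ b → u b + v b) + v (suc s)     ≡⟨ cong (_+ v (suc s)) (∑<-+ (suc s) u v) ⟩
    ∑< (suc s) u + ∑< (suc s) v + v (suc s)      ≡⟨ ℚP.+-assoc (∑< (suc s) u) (∑< (suc s) v) (v (suc s)) ⟩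
    ∑< (suc s) u + ∑< (suc (suc s)) v            ≡⟨ cong₂ _+_ (altSum⋆invFact≡1 s) (altInvFact⋆invFact-suc≡0 s) ⟩
    1ℚ + 0ℚ                                      ≡⟨ ℚP.+-identityʳ 1ℚ ⟩
    1ℚ                                           ∎
    where
    open ≡-Reasoning
    u v : ℕ → ℚ
    u b = altSum (s ∸ b) * invFact b
    v b = altInvFact (suc s ∸ b) * invFact b
    last : altSum (s ∸ s) ≡ altInvFact (s ∸ s)
    last rewrite ℕP.n∸n≡0 s = ℚP.+-identityˡ (altInvFact 0)
    term : ∀ b → b ℕ.< suc s → altSum (suc s ∸ b) * invFact b ≡ u b + v b
    term b b<s+1 rewrite ℕP.+-∸-assoc 1 (ℕP.≤-pred b<s+1) = ℚP.*-distribʳ-+ (invFact b) (altSum (s ∸ b)) _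

  sign-suc-suc : ∀ n → sign (suc (suc n)) ≡ sign n
  sign-suc-suc n = ℤP.neg-involutive (sign n)

  +-suc-suc : ∀ m n → m ℕ.+ suc (suc n) ≡ suc (suc m) ℕ.+ n
  +-suc-suc m n = trans (ℕP.+-suc m (suc n)) (cong suc (ℕP.+-suc m n))

  -- Evenness of n is expressed as sign n ≡ + 1, which n ↦ n + 2 preserves by sign-suc-suc.
  module _ (n : ℕ) (n-even : sign n ≡ + 1) where

    altInvFact-even : altInvFact n ≡ invFact n
    altInvFact-even = trans (cong (λ s → fromℤ s * invFact n) n-even) (ℚP.*-identityˡ (invFact n))

    altInvFact-suc-even : altInvFact (suc n) ≡ - invFact (suc n)
    altInvFact-suc-even = begin
      fromℤ (ℤ.- sign n) * invFact (suc n)  ≡⟨ cong (λ s → fromℤ (ℤ.- s) * invFact (suc n)) n-even ⟩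
      - 1ℚ * invFact (suc n)                ≡⟨ ℚP.neg-distribˡ-* 1ℚ (invFact (suc n)) ⟨
      - (1ℚ * invFact (suc n))              ≡⟨ cong -_ (ℚP.*-identityˡ (invFact (suc n))) ⟩
      - invFact (suc n)                     ∎
      where open ≡-Reasoning

    altSum-suc-even : altSum (suc n) ≡ altSum n - invFact (suc n)
    altSum-suc-even = cong (λ x → altSum n + x) altInvFact-suc-even

    altSum-suc-suc-even : altSum (suc (suc n)) ≡ altSum n - (invFact (suc n) - invFact (suc (suc n)))
    altSum-suc-suc-even = begin
      altSum (suc n) + fromℤ (sign (suc (suc n))) * invFact (suc (suc n))
        ≡⟨ cong₂ (λ S s → S + fromℤ s * invFact (suc (suc n))) altSum-suc-even (trans (sign-suc-suc n) n-even) ⟩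
      altSum n - invFact (suc n) + 1ℚ * invFact (suc (suc n))
        ≡⟨ solve 3 (λ S f g → S :- f :+ con 1ℚ :* g := S :- (f :- g)) refl (altSum n) (invFact (suc n)) (invFact (suc (suc n))) ⟩
      altSum n - (invFact (suc n) - invFact (suc (suc n)))  ∎
      where
      open ≡-Reasoning
      open +-*-Solver

    altSum-suc-suc-suc-even :
      altSum (suc (suc (suc n))) ≡ altSum (suc n) + (invFact (suc (suc n)) - invFact (suc (suc (suc n))))
    altSum-suc-suc-suc-even = begin
      altSum (suc n) + altInvFact (suc (suc n)) + fromℤ (sign (suc (suc (suc n)))) * invFact (suc (suc (suc n)))
        ≡⟨ cong₂ (λ s t → altSum (suc n) + fromℤ s * invFact (suc (suc n)) + fromℤ t * invFact (suc (suc (suc n))))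
                 (trans (sign-suc-suc n) n-even) (trans (sign-suc-suc (suc n)) (cong ℤ.-_ n-even)) ⟩
      altSum (suc n) + 1ℚ * invFact (suc (suc n)) + - 1ℚ * invFact (suc (suc (suc n)))
        ≡⟨ solve 3 (λ S f g → S :+ con 1ℚ :* f :+ :- con 1ℚ :* g := S :+ (f :- g)) refl (altSum (suc n)) (invFact (suc (suc n))) (invFact (suc (suc (suc n)))) ⟩
      altSum (suc n) + (invFact (suc (suc n)) - invFact (suc (suc (suc n)))) ∎
      where
      open ≡-Reasoning
      open +-*-Solver

  altSum-even-antitone : ∀ n → sign n ≡ + 1 → ∀ d → altSum (n ℕ.+ d) ≤ altSum n
  altSum-even-antitone n n-even zero = ℚP.≤-reflexive (cong altSum (ℕP.+-identityʳ n))
  altSum-even-antitone n n-even (suc zero) = begin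
    altSum (n ℕ.+ 1)            ≡⟨ cong altSum (ℕP.+-comm n 1) ⟩
    altSum (suc n)              ≡⟨ altSum-suc-even n n-even ⟩
    altSum n - invFact (suc n)  ≤⟨ p-q≤p (altSum n) (invFact-nonNeg (suc n)) ⟩
    altSum n                    ∎
    where open ℚP.≤-Reasoning
  altSum-even-antitone n n-even (suc (suc d)) = begin
    altSum (n ℕ.+ suc (suc d))  ≡⟨ cong altSum (+-suc-suc n d) ⟩
    altSum (suc (suc n) ℕ.+ d)  ≤⟨ altSum-even-antitone (suc (suc n)) (trans (sign-suc-suc n) n-even) d ⟩
    altSum (suc (suc n))        ≡⟨ altSum-suc-suc-even n n-even ⟩
    altSum n - (invFact (suc n) - invFact (suc (suc n)))
      ≤⟨ p-q≤p (altSum n) (p≤q⇒0≤q-p (invFact-antitone (ℕP.n≤1+n (suc n)))) ⟩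
    altSum n                    ∎
    where open ℚP.≤-Reasoning

  altSum-odd-monotone : ∀ n → sign n ≡ + 1 → ∀ d → altSum (suc n) ≤ altSum (suc n ℕ.+ d)
  altSum-odd-monotone n n-even zero = ℚP.≤-reflexive (cong altSum (sym (ℕP.+-identityʳ (suc n))))
  altSum-odd-monotone n n-even (suc zero) = begin
    altSum (suc n)                          ≤⟨ p≤p+q (altSum (suc n)) (invFact-nonNeg (suc (suc n))) ⟩
    altSum (suc n) + invFact (suc (suc n))  ≡⟨ cong (λ x → altSum (suc n) + x) (altInvFact-even (suc (suc n)) n+2-even) ⟨
    altSum (suc (suc n))                    ≡⟨ cong altSum (ℕP.+-comm 1 (suc n)) ⟩
    altSum (suc n ℕ.+ 1)                    ∎
    where
    open ℚP.≤-Reasoning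
    n+2-even : sign (suc (suc n)) ≡ + 1
    n+2-even = trans (sign-suc-suc n) n-even
  altSum-odd-monotone n n-even (suc (suc d)) = begin
    altSum (suc n)                ≤⟨ p≤p+q (altSum (suc n)) (p≤q⇒0≤q-p (invFact-antitone (ℕP.n≤1+n (suc (suc n))))) ⟩
    altSum (suc n) + (invFact (suc (suc n)) - invFact (suc (suc (suc n)))) ≡⟨ altSum-suc-suc-suc-even n n-even ⟨
    altSum (suc (suc (suc n)))    ≤⟨ altSum-odd-monotone (suc (suc n)) (trans (sign-suc-suc n) n-even) d ⟩
    altSum (suc (suc (suc n)) ℕ.+ d) ≡⟨ cong altSum (+-suc-suc (suc n) d) ⟨
    altSum (suc n ℕ.+ suc (suc d)) ∎
    where open ℚP.≤-Reasoning

  altSum-nonNeg : ∀ n → 0ℚ ≤ altSum n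
  altSum-nonNeg zero    = ℚP.≤-trans (ℚP.<⇒≤ (invFact-pos 0)) (ℚP.≤-reflexive (sym (altSum-zero)))
    where
    altSum-zero : altSum 0 ≡ invFact 0
    altSum-zero = trans (ℚP.+-identityˡ _) (ℚP.*-identityˡ (invFact 0))
  altSum-nonNeg (suc n) = ℚP.≤-trans (ℚP.≤-reflexive (sym altSum-one)) (altSum-odd-monotone 0 refl n)
    where
    altSum-one : altSum 1 ≡ 0ℚ
    altSum-one = cong₂ (λ f g → 0ℚ + 1ℚ * f + - 1ℚ * g) (invFact-unfold 0) (invFact-unfold 1)

  altSum≤1 : ∀ n → altSum n ≤ 1ℚ
  altSum≤1 n = ℚP.≤-trans (altSum-even-antitone 0 refl n)
    (ℚP.≤-reflexive (cong (λ f → 0ℚ + 1ℚ * f) (invFact-unfold 0)))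

  altSum-odd*eSum≤1 : ∀ n → sign n ≡ + 1 → ∀ k → altSum (suc n) * eSum k ≤ 1ℚ
  altSum-odd*eSum≤1 n n-even k = begin
    altSum o * eSum k                                  ≡⟨ cong (altSum o *_) (eSum≡∑<invFact k) ⟩
    altSum o * ∑< (suc k) invFact                      ≡⟨ ∑<-*ˡ (suc k) (altSum o) invFact ⟩
    ∑< (suc k) (λ b → altSum o * invFact b)            ≤⟨ ∑<-mono-≤ (suc k) raise ⟩
    ∑< (suc k) h                                       ≤⟨ p≤p+q (∑< (suc k) h) (∑<-nonNeg o (λ t _ → h-nonNeg (suc k ℕ.+ t))) ⟩
    ∑< (suc k) h + ∑< o (λ t → h (suc k ℕ.+ t))        ≡⟨ ∑<-split (suc k) o h ⟨
    ∑< (suc k ℕ.+ o) h                                 ≡⟨ cong (λ m → ∑< (suc m) h) (ℕP.+-comm k o) ⟩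
    ∑< (suc (o ℕ.+ k)) h                               ≡⟨ altSum⋆invFact≡1 (o ℕ.+ k) ⟩
    1ℚ                                                 ∎
    where
    open ℚP.≤-Reasoning
    o : ℕ
    o = suc n
    h : ℕ → ℚ
    h b = altSum (o ℕ.+ k ∸ b) * invFact b
    h-nonNeg : ∀ b → 0ℚ ≤ h b
    h-nonNeg b = 0≤p*q (altSum-nonNeg (o ℕ.+ k ∸ b)) (invFact-nonNeg b)
    raise : ∀ b → b ℕ.< suc k → altSum o * invFact b ≤ h b
    raise b b≤k rewrite ℕP.+-∸-assoc o (ℕP.≤-pred b≤k) =
      *-monoʳ-≤-nonNeg (invFact b) (invFact-nonNeg b) (altSum-odd-monotone n n-even (k ∸ b))

  invFact-2+n+n*invFact-3+n<invFact-1+n : ∀ n → invFact (2 ℕ.+ n) + fromℕ n * invFact (3 ℕ.+ n) < invFact (suc n)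
  invFact-2+n+n*invFact-3+n<invFact-1+n n = begin-strict
    invFact (2 ℕ.+ n) + fromℕ n * F                     ≡⟨ cong (_+ fromℕ n * F) (invFact-suc (2 ℕ.+ n)) ⟨
    F * fromℕ (3 ℕ.+ n) + fromℕ n * F
      ≡⟨ solve 3 (λ F a b → F :* a :+ b :* F := F :* (a :+ b)) refl F (fromℕ (3 ℕ.+ n)) (fromℕ n) ⟩
    F * (fromℕ (3 ℕ.+ n) + fromℕ n)                     ≡⟨ cong (F *_) (fromℕ-+ (3 ℕ.+ n) n) ⟨
    F * fromℕ (3 ℕ.+ n ℕ.+ n)
      <⟨ ℚP.*-monoʳ-<-pos F {{ℚ.positive (invFact-pos (3 ℕ.+ n))}} (fromℕ-mono-< 3+2n<[3+n][2+n]) ⟩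
    F * fromℕ ((3 ℕ.+ n) ℕ.* (2 ℕ.+ n))                 ≡⟨ cong (F *_) (fromℕ-* (3 ℕ.+ n) (2 ℕ.+ n)) ⟩
    F * (fromℕ (3 ℕ.+ n) * fromℕ (2 ℕ.+ n))             ≡⟨ ℚP.*-assoc F _ _ ⟨
    F * fromℕ (3 ℕ.+ n) * fromℕ (2 ℕ.+ n)               ≡⟨ cong (_* fromℕ (2 ℕ.+ n)) (invFact-suc (2 ℕ.+ n)) ⟩
    invFact (2 ℕ.+ n) * fromℕ (2 ℕ.+ n)                 ≡⟨ invFact-suc (suc n) ⟩
    invFact (suc n)                                     ∎
    where
    open ℚP.≤-Reasoning
    open +-*-Solver
    F : ℚ
    F = invFact (3 ℕ.+ n)
    3+2n<[3+n][2+n] : 3 ℕ.+ n ℕ.+ n ℕ.< (3 ℕ.+ n) ℕ.* (2 ℕ.+ n)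
    3+2n<[3+n][2+n] = subst (suc (3 ℕ.+ n ℕ.+ n) ℕ.≤_) (sym (expand n)) (ℕP.m≤m+n _ _)
      where
      expand : ∀ n → (3 ℕ.+ n) ℕ.* (2 ℕ.+ n) ≡ suc (3 ℕ.+ n ℕ.+ n) ℕ.+ (2 ℕ.+ 3 ℕ.* n ℕ.+ n ℕ.* n)
      expand = ℕSolver.solve-∀

  -- Split 1 = Σ_{b≤2n+2} S_{2n+2−b}/b! at b = 0 and b = n + 2 and bound each part by the
  -- corresponding part of S_n·(e's partial sum up to n + 2); what is left over is
  -- 1/(n+2)! + n/(n+3)! − 1/(n+1)! < 0.
  1<altSum-even*eSum : ∀ n → sign n ≡ + 1 → 1ℚ < altSum n * eSum (suc (suc n))
  1<altSum-even*eSum n n-even = begin-strict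
    1ℚ                                                  ≡⟨ altSum⋆invFact≡1 s ⟨
    ∑< (suc s) h                                        ≡⟨ cong (λ m → ∑< (suc m) h) (ℕP.+-comm n K) ⟩
    ∑< (suc K ℕ.+ n) h                                  ≡⟨ ∑<-split (suc K) n h ⟩
    ∑< (suc K) h + ∑< n (λ t → h (suc K ℕ.+ t))         ≡⟨ cong (_+ ∑< n (λ t → h (suc K ℕ.+ t))) (∑<-head K h) ⟩
    h 0 + ∑< K (λ b → h (suc b)) + ∑< n (λ t → h (suc K ℕ.+ t))
      ≤⟨ ℚP.+-mono-≤ (ℚP.+-mono-≤ head-bound (∑<-mono-≤ K middle-bound)) (∑<-≤-const n F₃ tail-bound) ⟩
    altSum n - (F₁ - F₂) + X + fromℕ n * F₃
      ≡⟨ solve 6 (λ S X f₁ f₂ m f₃ → S :- (f₁ :- f₂) :+ X :+ m :* f₃ := (S :+ X) :+ ((f₂ :+ m :* f₃) :- f₁)) refl (altSum n) X F₁ F₂ (fromℕ n) F₃ ⟩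
    altSum n + X + (F₂ + fromℕ n * F₃ - F₁)             <⟨ ℚP.+-monoʳ-< (altSum n + X) negative ⟩
    altSum n + X + 0ℚ                                   ≡⟨ ℚP.+-identityʳ (altSum n + X) ⟩
    altSum n + X                                        ≡⟨ factor ⟩
    altSum n * eSum K                                   ∎
    where
    open ℚP.≤-Reasoning
    open +-*-Solver
    K s : ℕ
    K = suc (suc n)
    s = n ℕ.+ K
    h : ℕ → ℚ
    h b = altSum (s ∸ b) * invFact b
    F₁ F₂ F₃ X : ℚ
    F₁ = invFact (suc n)
    F₂ = invFact (suc (suc n))
    F₃ = invFact (suc K)
    X = ∑< K (λ b → altSum n * invFact (suc b))
    head-bound : h 0 ≤ altSum n - (F₁ - F₂)
    head-bound = begin
      altSum s * invFact 0        ≡⟨ cong (altSum s *_) (invFact-unfold 0) ⟩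
      altSum s * 1ℚ               ≡⟨ ℚP.*-identityʳ (altSum s) ⟩
      altSum s                    ≡⟨ cong altSum (ℕP.+-comm n K) ⟩
      altSum (K ℕ.+ n)            ≤⟨ altSum-even-antitone K (trans (sign-suc-suc n) n-even) n ⟩
      altSum K                    ≡⟨ altSum-suc-suc-even n n-even ⟩
      altSum n - (F₁ - F₂)        ∎
    middle-bound : ∀ b → b ℕ.< K → h (suc b) ≤ altSum n * invFact (suc b)
    middle-bound b b<K rewrite ℕP.+-∸-assoc n b<K =
      *-monoʳ-≤-nonNeg (invFact (suc b)) (invFact-nonNeg (suc b)) (altSum-even-antitone n n-even (K ∸ suc b))
    tail-bound : ∀ t → t ℕ.< n → h (suc K ℕ.+ t) ≤ F₃
    tail-bound t _ = begin
      altSum (s ∸ (suc K ℕ.+ t)) * invFact (suc K ℕ.+ t)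
        ≤⟨ *-monoʳ-≤-nonNeg (invFact (suc K ℕ.+ t)) (invFact-nonNeg (suc K ℕ.+ t)) (altSum≤1 (s ∸ (suc K ℕ.+ t))) ⟩
      1ℚ * invFact (suc K ℕ.+ t)  ≡⟨ ℚP.*-identityˡ (invFact (suc K ℕ.+ t)) ⟩
      invFact (suc K ℕ.+ t)       ≤⟨ invFact-antitone (ℕP.m≤m+n (suc K) t) ⟩
      F₃                          ∎
    negative : F₂ + fromℕ n * F₃ - F₁ < 0ℚ
    negative = ℚP.<-≤-trans (ℚP.+-monoˡ-< (- F₁) (invFact-2+n+n*invFact-3+n<invFact-1+n n))
                            (ℚP.≤-reflexive (ℚP.+-inverseʳ F₁))
    factor : altSum n + X ≡ altSum n * eSum K
    factor = begin-equality
      altSum n + X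
        ≡⟨ cong₂ _+_ (ℚP.*-identityʳ (altSum n)) (∑<-*ˡ K (altSum n) (λ b → invFact (suc b))) ⟨
      altSum n * 1ℚ + altSum n * ∑< K (λ b → invFact (suc b)) ≡⟨ ℚP.*-distribˡ-+ (altSum n) 1ℚ _ ⟨
      altSum n * (1ℚ + ∑< K (λ b → invFact (suc b)))
        ≡⟨ cong (λ f → altSum n * (f + ∑< K (λ b → invFact (suc b)))) (invFact-unfold 0) ⟨
      altSum n * (invFact 0 + ∑< K (λ b → invFact (suc b))) ≡⟨ cong (altSum n *_) (trans (eSum≡∑<invFact K) (∑<-head K invFact)) ⟨
      altSum n * eSum K                                     ∎

  eSum-nonNeg : ∀ k → 0ℚ ≤ eSum k
  eSum-nonNeg k = ℚP.≤-trans (∑<-nonNeg (suc k) (λ i _ → invFact-nonNeg i)) (ℚP.≤-reflexive (sym (eSum≡∑<invFact k)))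

  LeDivE-downward : ∀ {m m′ N} → m ℕ.≤ m′ → LeDivE m′ N → LeDivE m N
  LeDivE-downward {m} {m′} {N} m≤m′ m′e≤N k = ℚP.≤-trans
    (*-monoʳ-≤-nonNeg (eSum k) (eSum-nonNeg k) (fromℕ-mono-≤ m≤m′)) (m′e≤N k)

  LeDivE∧LtDivE⇒⊥ : ∀ {m N} → LeDivE m N → LtDivE N m → ⊥
  LeDivE∧LtDivE⇒⊥ me≤N (k , N<me) = ℚP.<-irrefl refl (ℚP.<-≤-trans N<me (me≤N k))

  IsFloorDivE-unique : ∀ N {m m′} → IsFloorDivE N m → IsFloorDivE N m′ → m ≡ m′
  IsFloorDivE-unique N {m} {m′} (m≤ , <1+m) (m′≤ , <1+m′) with ℕP.<-cmp m m′
  ... | tri< m<m′ _ _ = ⊥-elim (LeDivE∧LtDivE⇒⊥ {suc m} {N} (LeDivE-downward {suc m} {m′} {N} m<m′ m′≤) <1+m)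
  ... | tri≈ _ m≡m′ _ = m≡m′
  ... | tri> _ _ m′<m = ⊥-elim (LeDivE∧LtDivE⇒⊥ {suc m′} {N} (LeDivE-downward {suc m′} {m} {N} m′<m m≤) <1+m′)

  derangements : ℕ → ℤ
  derangements zero    = + 1
  derangements (suc n) = + suc n ℤ.* derangements n ℤ.+ sign (suc n)

  fromℤ-derangements : ∀ n → fromℤ (derangements n) ≡ fromℕ (n !) * altSum n
  fromℤ-derangements zero    = cong (λ f → 1ℚ * (0ℚ + 1ℚ * f)) (sym (invFact-unfold 0))
  fromℤ-derangements (suc n) = begin
    fromℤ (+ suc n ℤ.* derangements n ℤ.+ sign (suc n))                ≡⟨ fromℤ-+ (+ suc n ℤ.* derangements n) (sign (suc n)) ⟩
    fromℤ (+ suc n ℤ.* derangements n) + fromℤ (sign (suc n))          ≡⟨ cong (_+ σ) (fromℤ-* (+ suc n) (derangements n)) ⟩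
    a * fromℤ (derangements n) + σ
      ≡⟨ cong₂ (λ x y → a * x + y) (fromℤ-derangements n) σ≡σ*f*fact ⟩
    a * (b * altSum n) + σ * (f * fromℕ (suc n !))
      ≡⟨ cong (λ x → a * (b * altSum n) + σ * (f * x)) (fromℕ-* (suc n) (n !)) ⟩
    a * (b * altSum n) + σ * (f * (a * b))
      ≡⟨ solve 5 (λ a b S σ f → a :* (b :* S) :+ σ :* (f :* (a :* b)) := (a :* b) :* (S :+ σ :* f)) refl a b (altSum n) σ f ⟩
    a * b * altSum (suc n)                                             ≡⟨ cong (_* altSum (suc n)) (fromℕ-* (suc n) (n !)) ⟨
    fromℕ (suc n !) * altSum (suc n)                                   ∎
    where
    open ≡-Reasoning
    open +-*-Solver
    a b σ f : ℚ
    a = fromℕ (suc n)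
    b = fromℕ (n !)
    σ = fromℤ (sign (suc n))
    f = invFact (suc n)
    σ≡σ*f*fact : σ ≡ σ * (f * fromℕ (suc n !))
    σ≡σ*f*fact = trans (sym (ℚP.*-identityʳ σ)) (cong (σ *_) (sym (invFact*fact≡1 (suc n))))

  derangements-even-pos : ∀ i → ∃ λ m → derangements (i ℕ.+ i) ≡ + suc m
  derangements-even-pos zero    = 0 , refl
  derangements-even-pos (suc i) with derangements-even-pos i
  ... | m , Dₑ≡1+m = suc (suc e) ℕ.* odd , (begin
    derangements (suc i ℕ.+ suc i)                           ≡⟨ cong derangements (cong suc (ℕP.+-suc i i)) ⟩
    + suc (suc e) ℤ.* derangements (suc e) ℤ.+ sign (suc (suc e))
      ≡⟨ cong₂ (λ x s → + suc (suc e) ℤ.* x ℤ.+ s) odd-step (trans (sign-suc-suc e) (sign-even i)) ⟩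
    + suc (suc e) ℤ.* + odd ℤ.+ + 1                          ≡⟨ cong (ℤ._+ + 1) (ℤP.pos-* (suc (suc e)) odd) ⟨
    + (suc (suc e) ℕ.* odd) ℤ.+ + 1                          ≡⟨ ℤP.pos-+ (suc (suc e) ℕ.* odd) 1 ⟨
    + (suc (suc e) ℕ.* odd ℕ.+ 1)                            ≡⟨ cong +_ (ℕP.+-comm (suc (suc e) ℕ.* odd) 1) ⟩
    + suc (suc (suc e) ℕ.* odd)                              ∎)
    where
    open ≡-Reasoning
    e odd : ℕ
    e = i ℕ.+ i
    odd = m ℕ.+ e ℕ.* suc m
    odd-step : derangements (suc e) ≡ + odd
    odd-step rewrite Dₑ≡1+m | sign-even i = refl

  -- The step from k to k + 1 uses the induction hypothesis at r + 1.
  leftFact-derangements-congruence : ∀ k r →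
    + (k ℕ.+ suc r) ∣ sign k ℤ.* (+ leftFact (k ℕ.+ suc r) ℤ.- + leftFact r) ℤ.- + (r !) ℤ.* derangements k
  leftFact-derangements-congruence zero    r = subst (+ suc r ∣_) (sym base) (Signed.divides (+ 0) refl)
    where
    base : + 1 ℤ.* (+ (leftFact r ℕ.+ r !) ℤ.- + leftFact r) ℤ.- + (r !) ℤ.* + 1 ≡ + 0
    base = trans (cong (λ x → + 1 ℤ.* (x ℤ.- + leftFact r) ℤ.- + (r !) ℤ.* + 1) (ℤP.pos-+ (leftFact r) (r !)))
                 (identity (+ leftFact r) (+ (r !)))
      where
      identity : ∀ L R → + 1 ℤ.* ((L ℤ.+ R) ℤ.- L) ℤ.- R ℤ.* + 1 ≡ + 0
      identity = ℤSolver.solve-∀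
  leftFact-derangements-congruence (suc k) r =
    subst (+ p ∣_) (sym (step (sign k) (+ leftFact p) (+ leftFact r) (+ (r !)) (derangements k) (+ suc k) (+ suc r)))
      (∣m∣n⇒∣m-n (∣m⇒∣-m ih) (∣m⇒∣m*n (+ (r !) ℤ.* derangements k) (∣-reflexive (ℤP.pos-+ (suc k) (suc r)))))
    where
    p : ℕ
    p = suc k ℕ.+ suc r
    ih : + p ∣ sign k ℤ.* (+ leftFact p ℤ.- (+ leftFact r ℤ.+ + (r !))) ℤ.- (+ suc r ℤ.* + (r !)) ℤ.* derangements k
    ih = subst₂ (λ L F → + p ∣ sign k ℤ.* (+ leftFact p ℤ.- L) ℤ.- F ℤ.* derangements k)
                (ℤP.pos-+ (leftFact r) (r !)) (ℤP.pos-* (suc r) (r !))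
                (subst (λ q → + q ∣ sign k ℤ.* (+ leftFact q ℤ.- + leftFact (suc r)) ℤ.- + (suc r !) ℤ.* derangements k)
                       (ℕP.+-suc k (suc r)) (leftFact-derangements-congruence k (suc r)))
    step : ∀ s Lp Lr R D k′ r′ →
      ℤ.- s ℤ.* (Lp ℤ.- Lr) ℤ.- R ℤ.* (k′ ℤ.* D ℤ.+ ℤ.- s)
      ≡ ℤ.- (s ℤ.* (Lp ℤ.- (Lr ℤ.+ R)) ℤ.- (r′ ℤ.* R) ℤ.* D) ℤ.- (k′ ℤ.+ r′) ℤ.* (R ℤ.* D)
    step = ℤSolver.solve-∀

  derangements≡leftFact : ∀ n → + suc n ∣ sign n ℤ.* + leftFact (suc n) ℤ.- derangements n
  derangements≡leftFact n = subst (+ suc n ∣_) (simplify (sign n) (+ leftFact (suc n)) (derangements n))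
    (subst (λ p → + p ∣ sign n ℤ.* (+ leftFact p ℤ.- + 0) ℤ.- + 1 ℤ.* derangements n)
           (ℕP.+-comm n 1) (leftFact-derangements-congruence n 0))
    where
    simplify : ∀ s L D → s ℤ.* (L ℤ.- + 0) ℤ.- + 1 ℤ.* D ≡ s ℤ.* L ℤ.- D
    simplify = ℤSolver.solve-∀

  module _ (n : ℕ) (n-even : sign n ≡ + 1) (m : ℕ) (Dₙ≡1+m : derangements n ≡ + suc m) where

    private
      N : ℕ
      N = n !

    1+m≡N*altSum : fromℕ (suc m) ≡ fromℕ N * altSum n
    1+m≡N*altSum = trans (cong fromℤ (sym Dₙ≡1+m)) (fromℤ-derangements n)

    m≤N*altSum-suc : fromℕ m ≤ fromℕ N * altSum (suc n)
    m≤N*altSum-suc = begin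
      fromℕ m                                    ≡⟨ solve 1 (λ x → x := (x :+ con 1ℚ) :- con 1ℚ) refl (fromℕ m) ⟩
      fromℕ m + 1ℚ - 1ℚ                          ≡⟨ cong (_- 1ℚ) (trans (sym (fromℕ-suc m)) 1+m≡N*altSum) ⟩
      fromℕ N * altSum n - 1ℚ                    ≤⟨ ℚP.+-monoʳ-≤ (fromℕ N * altSum n) (ℚP.neg-antimono-≤ N*invFact≤1) ⟩
      fromℕ N * altSum n - fromℕ N * invFact (suc n)
        ≡⟨ solve 3 (λ N S f → N :* S :- N :* f := N :* (S :- f)) refl (fromℕ N) (altSum n) (invFact (suc n)) ⟩
      fromℕ N * (altSum n - invFact (suc n))     ≡⟨ cong (fromℕ N *_) (altSum-suc-even n n-even) ⟨
      fromℕ N * altSum (suc n)                   ∎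
      where
      open ℚP.≤-Reasoning
      open +-*-Solver
      N*invFact≤1 : fromℕ N * invFact (suc n) ≤ 1ℚ
      N*invFact≤1 = begin
        fromℕ N * invFact (suc n)  ≤⟨ *-monoˡ-≤-nonNeg (fromℕ N) (fromℕ-nonNeg N) (invFact-antitone (ℕP.n≤1+n n)) ⟩
        fromℕ N * invFact n        ≡⟨ ℚP.*-comm (fromℕ N) (invFact n) ⟩
        invFact n * fromℕ N        ≡⟨ invFact*fact≡1 n ⟩
        1ℚ                         ∎

    derangements-pred-isFloorDivE : IsFloorDivE N m
    derangements-pred-isFloorDivE = below , (suc (suc n) , above)
      where
      open ℚP.≤-Reasoning
      below : LeDivE m N
      below k = begin
        fromℕ m * eSum k                           ≤⟨ *-monoʳ-≤-nonNeg (eSum k) (eSum-nonNeg k) m≤N*altSum-suc ⟩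
        fromℕ N * altSum (suc n) * eSum k          ≡⟨ ℚP.*-assoc (fromℕ N) (altSum (suc n)) (eSum k) ⟩
        fromℕ N * (altSum (suc n) * eSum k)        ≤⟨ *-monoˡ-≤-nonNeg (fromℕ N) (fromℕ-nonNeg N) (altSum-odd*eSum≤1 n n-even k) ⟩
        fromℕ N * 1ℚ                               ≡⟨ ℚP.*-identityʳ (fromℕ N) ⟩
        fromℕ N                                    ∎
      above : fromℕ N < fromℕ (suc m) * eSum (suc (suc n))
      above = begin-strict
        fromℕ N                                    ≡⟨ ℚP.*-identityʳ (fromℕ N) ⟨
        fromℕ N * 1ℚ
          <⟨ ℚP.*-monoʳ-<-pos (fromℕ N) {{ℚ.positive (fromℕ-pos N {{n !≢0}})}} (1<altSum-even*eSum n n-even) ⟩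
        fromℕ N * (altSum n * eSum (suc (suc n)))  ≡⟨ ℚP.*-assoc (fromℕ N) (altSum n) _ ⟨
        fromℕ N * altSum n * eSum (suc (suc n))    ≡⟨ cong (_* eSum (suc (suc n))) 1+m≡N*altSum ⟨
        fromℕ (suc m) * eSum (suc (suc n))         ∎

  leftFact-odd-congruence : ∀ j → Σ ℕ λ m →
    IsFloorDivE ((j ℕ.+ j) !) m × + suc (j ℕ.+ j) Unsigned.∣ + leftFact (suc (j ℕ.+ j)) ℤ.- + suc m
  leftFact-odd-congruence j with derangements-even-pos j
  ... | m , Dₙ≡1+m = m , derangements-pred-isFloorDivE n (sign-even j) m Dₙ≡1+m
                       , ∣⇒∣ᵤ (subst (λ x → + suc n ∣ x ℤ.- + suc m) (ℤP.*-identityˡ (+ leftFact (suc n))) p∣1*!p-1-m)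
    where
    n : ℕ
    n = j ℕ.+ j
    p∣1*!p-1-m : + suc n ∣ + 1 ℤ.* + leftFact (suc n) ℤ.- + suc m
    p∣1*!p-1-m = subst₂ (λ s D → + suc n ∣ s ℤ.* + leftFact (suc n) ℤ.- D) (sign-even j) Dₙ≡1+m (derangements≡leftFact n)

  even⊎odd : ∀ n → (∃ λ j → n ≡ j ℕ.+ j) ⊎ (∃ λ j → n ≡ suc (j ℕ.+ j))
  even⊎odd zero    = inj₁ (0 , refl)
  even⊎odd (suc n) with even⊎odd n
  ... | inj₁ (j , refl) = inj₂ (j , refl)
  ... | inj₂ (j , refl) = inj₁ (suc j , cong suc (sym (ℕP.+-suc j j)))

  prime≥3⇒odd : ∀ {p} → Prime p → 3 ℕ.≤ p → ∃ λ j → p ≡ suc (j ℕ.+ j)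
  prime≥3⇒odd {p} p-prime 3≤p with even⊎odd p
  ... | inj₂ p-odd      = p-odd
  ... | inj₁ (j , refl) = ⊥-elim (Prime.notComposite p-prime (composite {2} 3≤p (divides j (j+j≡j*2 j))))
    where
    j+j≡j*2 : ∀ j → j ℕ.+ j ≡ j ℕ.* 2
    j+j≡j*2 = ℕSolver.solve-∀

open import Data.Nat using (ℕ; suc; _≤_; _∸_; _!)
open import Data.Nat.Primality using (Prime)
open import Data.Integer using (+_; _-_)
open import Data.Integer.Divisibility using (_∣_)
open import Data.Product using (Σ; _×_; _,_)
open import Relation.Binary.PropositionalEquality using (refl; subst)

mainTheorem4 : (p : ℕ) → Prime p → 3 ≤ p →
    Σ ℕ (λ m → IsFloorDivE ((p ∸ 1) !) m)
    × ((m : ℕ) → IsFloorDivE ((p ∸ 1) !) m →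
         (+ p) ∣ ((+ leftFact p) - (+ suc m)))
mainTheorem4 p p-prime 3≤p with prime≥3⇒odd p-prime 3≤p
... | j , refl =
  let m , m-isFloor , p∣!p-1-m = leftFact-odd-congruence j
  in (m , m-isFloor) , λ m′ m′-isFloor →
       subst (λ x → (+ p) ∣ ((+ leftFact p) - (+ suc x))) (IsFloorDivE-unique ((p ∸ 1) !) m-isFloor m′-isFloor) p∣!p-1-m
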